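{- Let $V$ be a set and $\mathcal{E},\mathcal{F}$ families of subsets of $V$. Then $\langle V,\mathcal{E},\mathcal{F}\rangle$ has Property S if and only if $\langle V,[\mathcal{E}]_{\mathcal{F}},\mathcal{F}\rangle$ has Property S.
   Context: A set $X$ is a transversal for a family $\mathcal{A}$ if $X\cap A\neq\emptyset$ for every $A\in\mathcal{A}$. $\langle V,\mathcal{E},\mathcal{F}\rangle$ has Property S if there is $X\subseteq V$ such that $X$ is a transversal for $\mathcal{E}$ and $V\setminus X$ is a transversal for $\mathcal{F}$. Resolution: for subsets $c_1,\dots,c_n,d,e$ of $V$, $e$ follows from $c_1,\dots,c_n$ by resolution on $d$ if $d=\{v_1,\dots,v_n\}$ with $v_i\in c_i$ for $1\le i\le n$, and $e=\bigcup_{i=1}^n (c_i\setminus\{v_i\})$. For families $\mathcal{A},\mathcal{D}$ of subsets of $V$, $[\mathcal{A}]_{\mathcal{D}}$ denotes the closure of $\mathcal{A}$ under resolution on elements of $\mathcal{D}$, i.e. the smallest family containing $\mathcal{A}$ such that whenever $c_1,\dots,c_n$ belong to it and $e$ follows from them by resolution on some $d\in\mathcal{D}$, $e$ belongs to it. -}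

module Defs where

open import Level using (Level; _⊔_; suc)
open import Data.Nat using (ℕ)
open import Data.Fin using (Fin)
open import Data.Product using (Σ; ∃; _×_)
open import Relation.Binary.PropositionalEquality using (_≡_; _≢_)
open import Relation.Nullary using (¬_)
open import Relation.Unary using (Pred; _∈_)
open import Function.Bundles using (_⇔_)

Family : ∀ {a} (V : Set a) (ℓ f : Level) → Set (a ⊔ suc ℓ ⊔ suc f)
Family V ℓ f = Pred (Pred V ℓ) f

-- X ∩ A ≠ ∅, read constructively as: X and A have a common element.
Meets : ∀ {a ℓ ℓ'} {V : Set a} → Pred V ℓ → Pred V ℓ' → Set (a ⊔ ℓ ⊔ ℓ')
Meets {V = V} X A = Σ V (λ x → X x × A x)

Transversal : ∀ {a ℓ ℓ' f} {V : Set a} → Pred V ℓ' → Family V ℓ f → Set (a ⊔ suc ℓ ⊔ f ⊔ ℓ')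
Transversal X 𝒜 = ∀ A → 𝒜 A → Meets X A

Compl : ∀ {a ℓ} {V : Set a} → Pred V ℓ → Pred V ℓ
Compl X x = ¬ X x

PropertyS : ∀ {a ℓ f g} (V : Set a) → Family V ℓ f → Family V ℓ g → Set (a ⊔ suc ℓ ⊔ f ⊔ g)
PropertyS {ℓ = ℓ} V 𝓔 𝓕 =
  Σ (Pred V ℓ) (λ X → Transversal X 𝓔 × Transversal (Compl X) 𝓕)

-- e follows from c₁,…,cₙ by resolution on d (witnessed by v₁,…,vₙ):
-- vᵢ ∈ cᵢ, d = {v₁,…,vₙ}, e = ⋃ᵢ (cᵢ ∖ {vᵢ})  (set equalities are extensional).
record ResolutionStep {a ℓ} {V : Set a} (n : ℕ) (c : Fin n → Pred V ℓ)
                      (d e : Pred V ℓ) : Set (a ⊔ ℓ) where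
  field
    v     : Fin n → V
    v∈c   : ∀ i → c i (v i)
    d≐    : ∀ x → (d x ⇔ ∃ λ i → x ≡ v i)
    e≐    : ∀ x → (e x ⇔ ∃ λ i → c i x × x ≢ v i)

-- [𝒜]_𝒟 : the closure of 𝒜 under resolution on elements of 𝒟
-- (smallest family containing 𝒜 closed under such resolution steps).
data Closure {a ℓ f g} {V : Set a} (𝒜 : Family V ℓ f) (𝒟 : Family V ℓ g)
     : Pred (Pred V ℓ) (a ⊔ suc ℓ ⊔ f ⊔ g) where
  base : ∀ {e} → 𝒜 e → Closure 𝒜 𝒟 e
  res  : ∀ {e} (n : ℕ) (c : Fin n → Pred V ℓ) (d : Pred V ℓ) →
         𝒟 d → (∀ i → Closure 𝒜 𝒟 (c i)) → ResolutionStep n c d e →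
         Closure 𝒜 𝒟 e

module Submission where

open import Defs
open import Level using (Level)
open import Data.Nat using (ℕ)
open import Data.Fin using (Fin)
open import Data.Product using (_,_)
open import Function.Base using (_∘_)
open import Function.Bundles using (_⇔_; mk⇔; Equivalence)
open import Relation.Binary.PropositionalEquality using (subst; trans; sym)
open import Relation.Unary using (Pred)

-- A point x ∉ X of d is some vᵢ; a point y ∈ X of cᵢ differs from vᵢ, so y ∈ e.
resolvent-meets : ∀ {a ℓ ℓ'} {V : Set a} {X : Pred V ℓ'} {n : ℕ}
                  {c : Fin n → Pred V ℓ} {d e : Pred V ℓ} →
                  ResolutionStep n c d e → Meets (Compl X) d →
                  (∀ i → Meets X (c i)) → Meets X e
resolvent-meets {X = X} step (x , x∉X , x∈d) meets-c
  with Equivalence.to (ResolutionStep.d≐ step x) x∈d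
... | i , x≡vᵢ with meets-c i
... | y , y∈X , y∈cᵢ =
  y , y∈X , Equivalence.from (ResolutionStep.e≐ step y)
              (i , y∈cᵢ , λ y≡vᵢ → x∉X (subst X (trans y≡vᵢ (sym x≡vᵢ)) y∈X))

closure-transversal : ∀ {a ℓ ℓ' f g} {V : Set a} {𝓔 : Family V ℓ f} {𝓕 : Family V ℓ g}
                      {X : Pred V ℓ'} → Transversal X 𝓔 → Transversal (Compl X) 𝓕 →
                      Transversal X (Closure 𝓔 𝓕)
closure-transversal X-𝓔 X̅-𝓕 e (base e∈𝓔) = X-𝓔 e e∈𝓔
closure-transversal X-𝓔 X̅-𝓕 e (res n c d d∈𝓕 cᵢ∈closure step) =
  resolvent-meets step (X̅-𝓕 d d∈𝓕)
    (λ i → closure-transversal X-𝓔 X̅-𝓕 (c i) (cᵢ∈closure i))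

theorem7 : ∀ {a ℓ f g : Level} (V : Set a) (𝓔 : Family V ℓ f) (𝓕 : Family V ℓ g) →
    PropertyS V 𝓔 𝓕 ⇔ PropertyS V (Closure 𝓔 𝓕) 𝓕
theorem7 V 𝓔 𝓕 = mk⇔
  (λ { (X , X-𝓔 , X̅-𝓕) → X , closure-transversal X-𝓔 X̅-𝓕 , X̅-𝓕 })
  (λ { (X , X-closure , X̅-𝓕) → X , (λ A → X-closure A ∘ base) , X̅-𝓕 })
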